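{- Let $z:[n]\to[k]$ be any map, $\gamma\in\ker_{\mathbb Z}A_{n,z}$ and $w\in[n]$ with $q:=z(w)$. Define $\sigma_w(\gamma)\in\mathbb Z^{\binom n2}$ by, for distinct $u,v\in[n]$: $\sigma_w(\gamma)_{uv}=\gamma_{uv}$ if $z(u)\ne q$ and $z(v)\ne q$; $\sigma_w(\gamma)_{wv}=\sum_{u'\in z^{ -1}(q)}\gamma_{u'v}$ if $z(v)\ne q$; and $\sigma_w(\gamma)_{uv}=0$ in all remaining cases. Then $\sigma_w(\gamma)\in\ker_{\mathbb Z}A_{n,z}$.
   Context: Coordinates of $\mathbb Z^{\binom n2}$ are indexed by 2-subsets $\{u,v\}$ of $[n]$, with $\gamma_{uv}=\gamma_{vu}$. $A_{n,z}$ is the matrix obtained by stacking the vertex-edge incidence matrix of $K_n$ on top of the $\binom{k+1}2\times\binom n2$ matrix whose rows are indexed by pairs $(i,j)$, $1\le i\le j\le k$, and whose column $\{u,v\}$ has a single $1$ in row $(\min(z(u),z(v)),\max(z(u),z(v)))$. Equivalently $\gamma\in\ker_{\mathbb Z}A_{n,z}$ iff $\sum_u\gamma_{uv}=0$ for each $v$ and, for each $i\le j$, the sum of $\gamma_{uv}$ over $\{u,v\}$ with $\{z(u),z(v)\}=\{i,j\}$ is $0$. -}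

module Defs where

open import Data.Nat using (ℕ; zero; suc)
open import Data.Fin using (Fin; zero; suc; _≟_; _<?_; _≤_)
open import Data.Integer using (ℤ; 0ℤ; _+_)
open import Data.Bool using (Bool; true; false; if_then_else_; _∧_; _∨_; not)
open import Data.Product using (_×_)
open import Relation.Nullary.Decidable using (⌊_⌋)
open import Relation.Binary.PropositionalEquality using (_≡_)

∑ : ∀ {n} → (Fin n → ℤ) → ℤ
∑ {zero} f = 0ℤ
∑ {suc n} f = f zero + ∑ (λ i → f (suc i))

∑[_]_ : ∀ {n} → (Fin n → Bool) → (Fin n → ℤ) → ℤ
∑[ P ] f = ∑ (λ i → if P i then f i else 0ℤ)

-- Vectors of ℤ^(n choose 2) are modelled as symmetric functions
-- γ : Fin n → Fin n → ℤ ; values on the diagonal are irrelevant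
-- (never used by the kernel conditions below).
Symmetric : ∀ {n} → (Fin n → Fin n → ℤ) → Set
Symmetric γ = ∀ u v → γ u v ≡ γ v u

edgeClass : ∀ {n k} → (Fin n → Fin k) → Fin k → Fin k → Fin n → Fin n → Bool
edgeClass z i j u v =
  (⌊ z u ≟ i ⌋ ∧ ⌊ z v ≟ j ⌋) ∨ (⌊ z u ≟ j ⌋ ∧ ⌊ z v ≟ i ⌋)

-- γ ∈ ker_ℤ A_{n,z}
-- (1) vertex-edge incidence rows: for every v, Σ_{u ≠ v} γ_{uv} = 0;
-- (2) rows (i,j), i ≤ j: Σ over 2-subsets {u,v} (listed once as u < v)
--     with {z u, z v} = {i,j} of γ_{uv} is 0.
InKernel : ∀ {n k} → (Fin n → Fin k) → (Fin n → Fin n → ℤ) → Set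
InKernel {n} {k} z γ =
  (∀ (v : Fin n) → ∑[ (λ u → not ⌊ u ≟ v ⌋) ] (λ u → γ u v) ≡ 0ℤ)
  × (∀ (i j : Fin k) → i ≤ j →
       ∑ (λ u → ∑[ (λ v → ⌊ u <? v ⌋ ∧ edgeClass z i j u v) ] (λ v → γ u v)) ≡ 0ℤ)

σ : ∀ {n k} → (Fin n → Fin k) → Fin n → (Fin n → Fin n → ℤ) → Fin n → Fin n → ℤ
σ z w γ u v =
  if not ⌊ z u ≟ z w ⌋ ∧ not ⌊ z v ≟ z w ⌋ then γ u v
  else if ⌊ u ≟ w ⌋ ∧ not ⌊ z v ≟ z w ⌋
    then ∑[ (λ u' → ⌊ z u' ≟ z w ⌋) ] (λ u' → γ u' v)
  else if ⌊ v ≟ w ⌋ ∧ not ⌊ z u ≟ z w ⌋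
    then ∑[ (λ u' → ⌊ z u' ≟ z w ⌋) ] (λ u' → γ u' u)
  else 0ℤ

{-# OPTIONS --safe #-}

-- Let Q be the colour class of w. On edges with both ends outside Q, σ_w(γ)
-- agrees with γ; on edges inside Q it vanishes; and for v ∉ Q it moves the whole
-- weight that v receives from Q onto the single edge wv. Hence column sums at
-- vertices outside Q and block sums between Q and another colour class are
-- unchanged. The column of a vertex of Q is zero, except at w, where it is the
-- weight of the cut between Q and its complement; that cut vanishes for γ
-- because the vertex conditions summed over Q count it once and each edge inside
-- Q twice, and the edges inside Q sum to zero by the class condition (q, q).
-- The class conditions, which count each edge once through u < v, are compared
-- after doubling them into sums over ordered pairs of distinct vertices, which
-- loses nothing since ℤ is torsion-free.
module Submission where

open import Data.Bool using (Bool; true; false; if_then_else_; _∧_; _∨_; not; T)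
open import Data.Bool.Properties using (∧-zeroʳ; ∧-identityʳ; ∧-comm; ∨-comm; ∨-idem; T-∧; T-∨)
open import Data.Empty using (⊥; ⊥-elim)
open import Data.Fin using (Fin; zero; suc; _≟_; _<?_; _≤_)
open import Data.Fin.Properties using (≤-refl; <-cmp; <-asym; <-irrefl; <⇒≢)
open import Data.Integer using (ℤ; 0ℤ; _+_; +0; +[1+_]; -[1+_])
open import Data.Integer.Properties
  using (+-identityˡ; +-identityʳ; +-comm; +-0-commutativeMonoid; +-0-abelianGroup)
open import Data.Nat using (ℕ; zero; suc)
open import Data.Product using (_×_; _,_; proj₁)
import Data.Product as Product
open import Data.Sum using (_⊎_; inj₁; inj₂)
import Data.Sum as Sum
open import Data.Unit using (tt)
open import Function using (_∘_; id)
open import Function.Bundles using (Equivalence)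
open import Relation.Binary using (tri<; tri≈; tri>)
open import Relation.Binary.PropositionalEquality
  using (_≡_; _≢_; refl; sym; trans; cong; cong₂; module ≡-Reasoning)
open import Relation.Nullary using (Dec; yes; no; ¬_; contradiction)
open import Relation.Nullary.Decidable
  using (⌊_⌋; toWitness; toWitnessFalse; isYes≗does; dec-true; dec-false; ⌊⌋-map′)

open import Defs

open import Algebra.Properties.CommutativeMonoid.Sum +-0-commutativeMonoid as MonoidSum using (sum)
open import Algebra.Properties.AbelianGroup +-0-abelianGroup using (∙-cancelʳ)

open ≡-Reasoning

[_]_ : Bool → ℤ → ℤ
[ b ] x = if b then x else 0ℤ

[]-zero : ∀ b → [ b ] 0ℤ ≡ 0ℤ
[]-zero true  = refl
[]-zero false = refl

[]-∧ : ∀ a b x → [ a ∧ b ] x ≡ [ a ] [ b ] x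
[]-∧ true  b x = refl
[]-∧ false b x = refl

[]-comm : ∀ a b x → [ a ] [ b ] x ≡ [ b ] [ a ] x
[]-comm true  b     x = refl
[]-comm false true  x = refl
[]-comm false false x = refl

[]-cong : ∀ b {x y} → (T b → x ≡ y) → [ b ] x ≡ [ b ] y
[]-cong true  x≡y = x≡y tt
[]-cong false _   = refl

[]-+ : ∀ b x y → [ b ] (x + y) ≡ [ b ] x + [ b ] y
[]-+ true  x y = refl
[]-+ false x y = refl

[]-∨-disjoint : ∀ a b c d x → (T a → T c → ⊥) → [ (a ∧ b) ∨ (c ∧ d) ] x ≡ [ a ] [ b ] x + [ c ] [ d ] x
[]-∨-disjoint true  b     true  d x a∧c = ⊥-elim (a∧c tt tt)
[]-∨-disjoint true  true  false d x _   = sym (+-identityʳ x)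
[]-∨-disjoint true  false false d x _   = refl
[]-∨-disjoint false b     c     d x _   = trans ([]-∧ c d x) (sym (+-identityˡ _))

[]-split : ∀ b x → x ≡ [ b ] x + [ not b ] x
[]-split true  x = sym (+-identityʳ x)
[]-split false x = sym (+-identityˡ x)

⌊⌋-true : ∀ {a} {A : Set a} (a? : Dec A) → A → ⌊ a? ⌋ ≡ true
⌊⌋-true a? a = trans (isYes≗does a?) (dec-true a? a)

⌊⌋-false : ∀ {a} {A : Set a} (a? : Dec A) → ¬ A → ⌊ a? ⌋ ≡ false
⌊⌋-false a? ¬a = trans (isYes≗does a?) (dec-false a? ¬a)

∑≡sum : ∀ {n} (f : Fin n → ℤ) → ∑ f ≡ sum f
∑≡sum {zero}  f = refl
∑≡sum {suc n} f = cong (f zero +_) (∑≡sum (f ∘ suc))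

-- Opened at a fixed n below, so that the implicit length of ∑ is never left to
-- be inferred from underscore arguments.
module Sums {n : ℕ} where

  ∑-cong : {f g : Fin n → ℤ} → (∀ i → f i ≡ g i) → ∑ f ≡ ∑ g
  ∑-cong {f} {g} f≗g = begin
    ∑ f    ≡⟨ ∑≡sum f ⟩
    sum f  ≡⟨ MonoidSum.sum-cong-≗ f≗g ⟩
    sum g  ≡⟨ ∑≡sum g ⟨
    ∑ g    ∎

  ∑-zero : {f : Fin n → ℤ} → (∀ i → f i ≡ 0ℤ) → ∑ f ≡ 0ℤ
  ∑-zero f≗0 = trans (∑-cong f≗0) (trans (∑≡sum {n} (λ _ → 0ℤ)) (MonoidSum.sum-replicate-zero n))

  ∑-distrib-+ : (f g : Fin n → ℤ) → ∑ (λ i → f i + g i) ≡ ∑ f + ∑ g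
  ∑-distrib-+ f g = begin
    ∑ (λ i → f i + g i)    ≡⟨ ∑≡sum (λ i → f i + g i) ⟩
    sum (λ i → f i + g i)  ≡⟨ MonoidSum.∑-distrib-+ f g ⟩
    sum f + sum g          ≡⟨ cong₂ _+_ (∑≡sum f) (∑≡sum g) ⟨
    ∑ f + ∑ g              ∎

  ∑-comm : (f : Fin n → Fin n → ℤ) → ∑ (λ i → ∑ (f i)) ≡ ∑ (λ j → ∑ (λ i → f i j))
  ∑-comm f = begin
    ∑ (λ i → ∑ (f i))                ≡⟨ ∑-cong (λ i → ∑≡sum (f i)) ⟩
    ∑ (λ i → sum (f i))              ≡⟨ ∑≡sum (λ i → sum (f i)) ⟩
    sum (λ i → sum (f i))            ≡⟨ MonoidSum.∑-comm f ⟩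
    sum (λ j → sum (λ i → f i j))    ≡⟨ ∑≡sum (λ j → sum (λ i → f i j)) ⟨
    ∑ (λ j → sum (λ i → f i j))      ≡⟨ ∑-cong (λ j → ∑≡sum (λ i → f i j)) ⟨
    ∑ (λ j → ∑ (λ i → f i j))        ∎

  ∑-[] : ∀ b (f : Fin n → ℤ) → ∑ (λ i → [ b ] f i) ≡ [ b ] ∑ f
  ∑-[] true  f = refl
  ∑-[] false f = ∑-zero (λ _ → refl)

  ∑-split : (P : Fin n → Bool) (f : Fin n → ℤ) → ∑ f ≡ ∑[ P ] f + ∑[ not ∘ P ] f
  ∑-split P f = trans (∑-cong (λ i → []-split (P i) (f i))) (∑-distrib-+ _ _)

  ∑[]-cong : (P : Fin n → Bool) {f g : Fin n → ℤ} → (∀ i → T (P i) → f i ≡ g i) → ∑[ P ] f ≡ ∑[ P ] g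
  ∑[]-cong P f≗g = ∑-cong (λ i → []-cong (P i) (f≗g i))

∑-δ : ∀ {n} (w : Fin n) (f : Fin n → ℤ) → ∑ (λ i → [ ⌊ i ≟ w ⌋ ] f i) ≡ f w
∑-δ {suc n} zero    f = trans (cong (f zero +_) (Sums.∑-zero {n} (λ _ → refl))) (+-identityʳ (f zero))
∑-δ {suc n} (suc w) f = trans (+-identityˡ _) (begin
  ∑ (λ i → [ ⌊ suc i ≟ suc w ⌋ ] f (suc i))
    ≡⟨ Sums.∑-cong (λ i → cong ([_] f (suc i)) (⌊⌋-map′ _ _ (i ≟ w))) ⟩
  ∑ (λ i → [ ⌊ i ≟ w ⌋ ] f (suc i))
    ≡⟨ ∑-δ w (f ∘ suc) ⟩
  f (suc w)
    ∎)

x+x≡0⇒x≡0 : ∀ x → x + x ≡ 0ℤ → x ≡ 0ℤ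
x+x≡0⇒x≡0 +0       _ = refl
x+x≡0⇒x≡0 +[1+ m ] ()
x+x≡0⇒x≡0 -[1+ m ]  ()

module _ {n : ℕ} where

  open Sums {n}

  ∑-punctured : (v : Fin n) (f : Fin n → ℤ) → ∑[ (λ u → not ⌊ u ≟ v ⌋) ] f + f v ≡ ∑ f
  ∑-punctured v f = begin
    ∑[ ≢v ] f + f v            ≡⟨ +-comm (∑[ ≢v ] f) (f v) ⟩
    f v + ∑[ ≢v ] f            ≡⟨ cong (_+ ∑[ ≢v ] f) (∑-δ v f) ⟨
    ∑[ ≡v ] f + ∑[ ≢v ] f      ≡⟨ ∑-split ≡v f ⟨
    ∑ f                        ∎
    where
    ≡v ≢v : Fin n → Bool
    ≡v u = ⌊ u ≟ v ⌋
    ≢v u = not ⌊ u ≟ v ⌋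

  [≢]≡[<]+[>] : (u v : Fin n) (x : ℤ) → [ not ⌊ u ≟ v ⌋ ] x ≡ [ ⌊ u <? v ⌋ ] x + [ ⌊ v <? u ⌋ ] x
  [≢]≡[<]+[>] u v x with <-cmp u v
  ... | tri< u<v _ _
    rewrite ⌊⌋-false (u ≟ v) (<⇒≢ u<v) | ⌊⌋-true (u <? v) u<v | ⌊⌋-false (v <? u) (<-asym u<v)
    = sym (+-identityʳ x)
  ... | tri≈ _ refl _
    rewrite ⌊⌋-true (u ≟ u) refl | ⌊⌋-false (u <? u) (<-irrefl refl)
    = refl
  ... | tri> _ _ v<u
    rewrite ⌊⌋-false (u ≟ v) (<⇒≢ v<u ∘ sym) | ⌊⌋-false (u <? v) (<-asym v<u) | ⌊⌋-true (v <? u) v<u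
    = sym (+-identityˡ x)

  ∑∑-distrib-+ : (f g : Fin n → Fin n → ℤ) →
    ∑ (λ v → ∑ (λ u → f v u + g v u)) ≡ ∑ (λ v → ∑ (f v)) + ∑ (λ v → ∑ (g v))
  ∑∑-distrib-+ f g = trans (∑-cong (λ v → ∑-distrib-+ (f v) (g v))) (∑-distrib-+ _ _)

  vertexSum : (Fin n → Fin n → ℤ) → Fin n → ℤ
  vertexSum h v = ∑[ (λ u → not ⌊ u ≟ v ⌋) ] (λ u → h u v)

  vertexSum-cong : (h h′ : Fin n → Fin n → ℤ) (v : Fin n) →
    ∑ (λ u → h u v) ≡ ∑ (λ u → h′ u v) → h v v ≡ h′ v v → vertexSum h v ≡ vertexSum h′ v
  vertexSum-cong h h′ v ∑h≡∑h′ hvv≡h′vv = ∙-cancelʳ (h v v) _ _ (begin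
    vertexSum h v + h v v     ≡⟨ ∑-punctured v (λ u → h u v) ⟩
    ∑ (λ u → h u v)           ≡⟨ ∑h≡∑h′ ⟩
    ∑ (λ u → h′ u v)          ≡⟨ ∑-punctured v (λ u → h′ u v) ⟨
    vertexSum h′ v + h′ v v   ≡⟨ cong (vertexSum h′ v +_) hvv≡h′vv ⟨
    vertexSum h′ v + h v v    ∎)

  offDiagonalSum : (Fin n → Fin n → ℤ) → ℤ
  offDiagonalSum h = ∑ (vertexSum h)

  upperSum : (Fin n → Fin n → ℤ) → ℤ
  upperSum h = ∑ (λ u → ∑[ (λ v → ⌊ u <? v ⌋) ] (h u))

  offDiagonalSum≡2*upperSum : (h : Fin n → Fin n → ℤ) → Symmetric h →
    offDiagonalSum h ≡ upperSum h + upperSum h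
  offDiagonalSum≡2*upperSum h h-sym = begin
    offDiagonalSum h
      ≡⟨ ∑-cong (λ v → ∑-cong (λ u → [≢]≡[<]+[>] u v (h u v))) ⟩
    ∑ (λ v → ∑ (λ u → [ ⌊ u <? v ⌋ ] h u v + [ ⌊ v <? u ⌋ ] h u v))
      ≡⟨ ∑∑-distrib-+ _ _ ⟩
    ∑ (λ v → ∑ (λ u → [ ⌊ u <? v ⌋ ] h u v)) + ∑ (λ v → ∑ (λ u → [ ⌊ v <? u ⌋ ] h u v))
      ≡⟨ cong₂ _+_ (∑-comm (λ v u → [ ⌊ u <? v ⌋ ] h u v))
                   (∑-cong (λ v → ∑-cong (λ u → cong ([ ⌊ v <? u ⌋ ]_) (h-sym u v)))) ⟩
    upperSum h + upperSum h
      ∎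

  offDiagonalSum≡∑∑ : (g : Fin n → Fin n → ℤ) → (∀ u → g u u ≡ 0ℤ) →
    offDiagonalSum g ≡ ∑ (λ v → ∑ (λ u → g u v))
  offDiagonalSum≡∑∑ g g-diag = ∑-cong (λ v → ∑-cong (λ u → off-diagonal u v))
    where
    off-diagonal : ∀ u v → [ not ⌊ u ≟ v ⌋ ] g u v ≡ g u v
    off-diagonal u v with u ≟ v
    ... | yes refl = sym (g-diag u)
    ... | no _     = refl

  offDiagonalSum-cong : {g g′ : Fin n → Fin n → ℤ} → (∀ u v → g u v ≡ g′ u v) →
    offDiagonalSum g ≡ offDiagonalSum g′
  offDiagonalSum-cong g≗g′ = ∑-cong (λ v → ∑-cong (λ u → cong ([ not ⌊ u ≟ v ⌋ ]_) (g≗g′ u v)))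

  blockSum : (Fin n → Fin n → ℤ) → (Fin n → Bool) → (Fin n → Bool) → ℤ
  blockSum h P R = ∑[ R ] (λ v → ∑[ P ] (λ u → h u v))

  blockSum≡∑∑ : (h : Fin n → Fin n → ℤ) (P R : Fin n → Bool) →
    blockSum h P R ≡ ∑ (λ v → ∑ (λ u → [ P u ] [ R v ] h u v))
  blockSum≡∑∑ h P R = ∑-cong (λ v → trans (sym (∑-[] (R v) _)) (∑-cong (λ u → []-comm (R v) (P u) (h u v))))

  blockSum-transpose : (h : Fin n → Fin n → ℤ) → Symmetric h → (P R : Fin n → Bool) →
    blockSum h P R ≡ blockSum h R P
  blockSum-transpose h h-sym P R = begin
    blockSum h P R                                ≡⟨ blockSum≡∑∑ h P R ⟩
    ∑ (λ v → ∑ (λ u → [ P u ] [ R v ] h u v))     ≡⟨ ∑-comm _ ⟩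
    ∑ (λ u → ∑ (λ v → [ P u ] [ R v ] h u v))     ≡⟨ ∑-cong (λ u → ∑-cong (λ v → swap u v)) ⟩
    ∑ (λ u → ∑ (λ v → [ R v ] [ P u ] h v u))     ≡⟨ blockSum≡∑∑ h R P ⟨
    blockSum h R P                                ∎
    where
    swap : ∀ u v → [ P u ] [ R v ] h u v ≡ [ R v ] [ P u ] h v u
    swap u v = trans ([]-comm (P u) (R v) (h u v)) (cong (λ x → [ R v ] [ P u ] x) (h-sym u v))

  module _ {k : ℕ} (z : Fin n → Fin k) where

    fibre : Fin k → Fin n → Bool
    fibre i u = ⌊ z u ≟ i ⌋

    onClass : Fin k → Fin k → (Fin n → Fin n → ℤ) → Fin n → Fin n → ℤ
    onClass i j h u v = [ edgeClass z i j u v ] h u v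

    classSum : (Fin n → Fin n → ℤ) → Fin k → Fin k → ℤ
    classSum h i j = ∑ (λ u → ∑[ (λ v → ⌊ u <? v ⌋ ∧ edgeClass z i j u v) ] (h u))

    edgeClass-sym : ∀ i j u v → edgeClass z i j u v ≡ edgeClass z i j v u
    edgeClass-sym i j u v =
      trans (cong₂ _∨_ (∧-comm (fibre i u) (fibre j v)) (∧-comm (fibre j u) (fibre i v)))
            (∨-comm (fibre j v ∧ fibre i u) (fibre i v ∧ fibre j u))

    edgeClass-comm : ∀ i j u v → edgeClass z i j u v ≡ edgeClass z j i u v
    edgeClass-comm i j u v = ∨-comm (fibre i u ∧ fibre j v) (fibre j u ∧ fibre i v)

    edgeClass-colours : ∀ {i j u v} → T (edgeClass z i j u v) →
      (z u ≡ i × z v ≡ j) ⊎ (z u ≡ j × z v ≡ i)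
    edgeClass-colours {i} {j} {u} {v} =
      Sum.map (colours i j) (colours j i) ∘ Equivalence.to T-∨
      where
      colours : ∀ a b → T (fibre a u ∧ fibre b v) → z u ≡ a × z v ≡ b
      colours a b = Product.map (toWitness {a? = z u ≟ a}) (toWitness {a? = z v ≟ b}) ∘ Equivalence.to T-∧

    edgeClass-avoids : ∀ {i j u v c} → i ≢ c → j ≢ c → T (edgeClass z i j u v) → z u ≢ c × z v ≢ c
    edgeClass-avoids {i} {j} {u} {v} {c} i≢c j≢c = avoid ∘ edgeClass-colours
      where
      avoid : (z u ≡ i × z v ≡ j) ⊎ (z u ≡ j × z v ≡ i) → z u ≢ c × z v ≢ c
      avoid (inj₁ (ui , vj)) = (λ uc → i≢c (trans (sym ui) uc)) , (λ vc → j≢c (trans (sym vj) vc))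
      avoid (inj₂ (uj , vi)) = (λ uc → j≢c (trans (sym uj) uc)) , (λ vc → i≢c (trans (sym vi) vc))

    edgeClass-diagonal : ∀ {i u v} → T (edgeClass z i i u v) → z u ≡ i × z v ≡ i
    edgeClass-diagonal = Sum.[ id , id ] ∘ edgeClass-colours

    classSum-double : ∀ h → Symmetric h → ∀ i j →
      classSum h i j + classSum h i j ≡ offDiagonalSum (onClass i j h)
    classSum-double h h-sym i j = sym (begin
      offDiagonalSum (onClass i j h)
        ≡⟨ offDiagonalSum≡2*upperSum (onClass i j h) onClass-sym ⟩
      upperSum (onClass i j h) + upperSum (onClass i j h)
        ≡⟨ cong₂ _+_ upper≡classSum upper≡classSum ⟩
      classSum h i j + classSum h i j
        ∎)
      where
      onClass-sym : Symmetric (onClass i j h)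
      onClass-sym u v = cong₂ [_]_ (edgeClass-sym i j u v) (h-sym u v)
      upper≡classSum : upperSum (onClass i j h) ≡ classSum h i j
      upper≡classSum = ∑-cong (λ u → ∑-cong (λ v → sym ([]-∧ ⌊ u <? v ⌋ (edgeClass z i j u v) (h u v))))

    ∑-vertexSum-fibre : ∀ h i →
      ∑[ fibre i ] (vertexSum h) ≡ offDiagonalSum (onClass i i h) + blockSum h (not ∘ fibre i) (fibre i)
    ∑-vertexSum-fibre h i = begin
      ∑[ Z ] (vertexSum h)
        ≡⟨ ∑-cong (λ v → trans ([]-cong (Z v) (split v)) ([]-+ (Z v) _ _)) ⟩
      ∑ (λ v → [ Z v ] inner v + [ Z v ] outer v)
        ≡⟨ ∑-distrib-+ _ _ ⟩
      ∑[ Z ] inner + ∑[ Z ] outer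
        ≡⟨ cong (_+ ∑[ Z ] outer) inner≡offDiagonal ⟩
      offDiagonalSum (onClass i i h) + blockSum h (not ∘ Z) Z
        ∎
      where
      Z : Fin n → Bool
      Z = fibre i
      inner outer : Fin n → ℤ
      inner v = ∑[ Z ] (λ u → [ not ⌊ u ≟ v ⌋ ] h u v)
      outer v = ∑[ not ∘ Z ] (λ u → h u v)
      split : ∀ v → T (Z v) → vertexSum h v ≡ inner v + outer v
      split v Zv = trans (∑-split Z _) (cong (inner v +_) (∑[]-cong (not ∘ Z) (λ u ¬Zu →
        cong (λ b → [ not b ] h u v)
             (⌊⌋-false (u ≟ v) (λ u≡v → toWitnessFalse ¬Zu (trans (cong z u≡v) (toWitness Zv)))))))
      reorder : ∀ u v → [ Z v ] [ Z u ] [ not ⌊ u ≟ v ⌋ ] h u v ≡ [ not ⌊ u ≟ v ⌋ ] onClass i i h u v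
      reorder u v = begin
        [ Z v ] [ Z u ] [ uv ] x   ≡⟨ []-comm (Z v) (Z u) _ ⟩
        [ Z u ] [ Z v ] [ uv ] x   ≡⟨ cong ([ Z u ]_) ([]-comm (Z v) uv x) ⟩
        [ Z u ] [ uv ] [ Z v ] x   ≡⟨ []-comm (Z u) uv _ ⟩
        [ uv ] [ Z u ] [ Z v ] x   ≡⟨ cong ([ uv ]_) ([]-∧ (Z u) (Z v) x) ⟨
        [ uv ] [ Z u ∧ Z v ] x     ≡⟨ cong (λ b → [ uv ] [ b ] x) (∨-idem (Z u ∧ Z v)) ⟨
        [ uv ] [ edgeClass z i i u v ] x ∎
        where
        uv : Bool
        uv = not ⌊ u ≟ v ⌋
        x : ℤ
        x = h u v
      inner≡offDiagonal : ∑[ Z ] inner ≡ offDiagonalSum (onClass i i h)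
      inner≡offDiagonal = ∑-cong (λ v → trans (sym (∑-[] (Z v) _)) (∑-cong (λ u → reorder u v)))

    onClass-diagonal : ∀ h {i j} → i ≢ j → ∀ u → onClass i j h u u ≡ 0ℤ
    onClass-diagonal h {i} {j} i≢j u =
      trans ([]-cong (edgeClass z i j u u) (λ t → ⊥-elim (i≢j (same-colour (edgeClass-colours t)))))
            ([]-zero _)
      where
      same-colour : (z u ≡ i × z u ≡ j) ⊎ (z u ≡ j × z u ≡ i) → i ≡ j
      same-colour (inj₁ (ui , uj)) = trans (sym ui) uj
      same-colour (inj₂ (uj , ui)) = trans (sym ui) uj

    offDiagonalSum-onClass-distinct : ∀ h {i j} → i ≢ j →
      offDiagonalSum (onClass i j h) ≡ blockSum h (fibre i) (fibre j) + blockSum h (fibre j) (fibre i)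
    offDiagonalSum-onClass-distinct h {i} {j} i≢j = begin
      offDiagonalSum (onClass i j h)
        ≡⟨ offDiagonalSum≡∑∑ (onClass i j h) (onClass-diagonal h i≢j) ⟩
      ∑ (λ v → ∑ (λ u → onClass i j h u v))
        ≡⟨ ∑-cong (λ v → ∑-cong (λ u → []-∨-disjoint (fibre i u) (fibre j v) (fibre j u) (fibre i v) (h u v)
                                           (λ ui uj → i≢j (trans (sym (toWitness ui)) (toWitness uj))))) ⟩
      ∑ (λ v → ∑ (λ u → [ fibre i u ] [ fibre j v ] h u v + [ fibre j u ] [ fibre i v ] h u v))
        ≡⟨ ∑∑-distrib-+ _ _ ⟩
      ∑ (λ v → ∑ (λ u → [ fibre i u ] [ fibre j v ] h u v))
        + ∑ (λ v → ∑ (λ u → [ fibre j u ] [ fibre i v ] h u v))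
        ≡⟨ cong₂ _+_ (blockSum≡∑∑ h (fibre i) (fibre j)) (blockSum≡∑∑ h (fibre j) (fibre i)) ⟨
      blockSum h (fibre i) (fibre j) + blockSum h (fibre j) (fibre i)
        ∎

    offDiagonalSum-onClass-comm : ∀ h i j → offDiagonalSum (onClass i j h) ≡ offDiagonalSum (onClass j i h)
    offDiagonalSum-onClass-comm h i j = offDiagonalSum-cong (λ u v → cong ([_] h u v) (edgeClass-comm i j u v))

    offDiagonalSum-onClass-zero : ∀ h → Symmetric h → ∀ i j →
      classSum h i j ≡ 0ℤ → offDiagonalSum (onClass i j h) ≡ 0ℤ
    offDiagonalSum-onClass-zero h h-sym i j class≡0 =
      trans (sym (classSum-double h h-sym i j)) (cong₂ _+_ class≡0 class≡0)

    classSum-zero : ∀ h → Symmetric h → ∀ i j →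
      offDiagonalSum (onClass i j h) ≡ 0ℤ → classSum h i j ≡ 0ℤ
    classSum-zero h h-sym i j offDiagonal≡0 =
      x+x≡0⇒x≡0 _ (trans (classSum-double h h-sym i j) offDiagonal≡0)

module _ {n k : ℕ} (z : Fin n → Fin k) (w : Fin n) (γ : Fin n → Fin n → ℤ) where

  open Sums {n}

  private
    Q : Fin n → Bool
    Q = fibre z (z w)

    σγ : Fin n → Fin n → ℤ
    σγ = σ z w γ

  hubWeight : Fin n → ℤ
  hubWeight v = ∑[ Q ] (λ u → γ u v)

  σ-outside : ∀ {u v} → z u ≢ z w → z v ≢ z w → σγ u v ≡ γ u v
  σ-outside {u} {v} u∉Q v∉Q with z u ≟ z w | z v ≟ z w
  ... | yes u∈Q | _       = contradiction u∈Q u∉Q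
  ... | no _    | yes v∈Q = contradiction v∈Q v∉Q
  ... | no _    | no _    = refl

  σ-inside : ∀ {u v} → z u ≡ z w → z v ≡ z w → σγ u v ≡ 0ℤ
  σ-inside {u} {v} u∈Q v∈Q with z u ≟ z w | z v ≟ z w
  ... | no u∉Q | _       = contradiction u∈Q u∉Q
  ... | yes _  | no v∉Q  = contradiction v∈Q v∉Q
  ... | yes _  | yes _   rewrite ∧-zeroʳ ⌊ u ≟ w ⌋ | ∧-zeroʳ ⌊ v ≟ w ⌋ = refl

  σ-crossˡ : ∀ {u v} → z u ≡ z w → z v ≢ z w → σγ u v ≡ [ ⌊ u ≟ w ⌋ ] hubWeight v
  σ-crossˡ {u} {v} u∈Q v∉Q with z u ≟ z w | z v ≟ z w
  ... | no u∉Q | _       = contradiction u∈Q u∉Q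
  ... | yes _  | yes v∈Q = contradiction v∈Q v∉Q
  ... | yes _  | no _    rewrite ∧-identityʳ ⌊ u ≟ w ⌋ | ∧-zeroʳ ⌊ v ≟ w ⌋ = refl

  σ-crossʳ : ∀ {u v} → z u ≢ z w → z v ≡ z w → σγ u v ≡ [ ⌊ v ≟ w ⌋ ] hubWeight u
  σ-crossʳ {u} {v} u∉Q v∈Q with z u ≟ z w | z v ≟ z w
  ... | yes u∈Q | _      = contradiction u∈Q u∉Q
  ... | no _    | no v∉Q = contradiction v∈Q v∉Q
  ... | no _    | yes _  rewrite ∧-zeroʳ ⌊ u ≟ w ⌋ | ∧-identityʳ ⌊ v ≟ w ⌋ = refl

  σ-symmetric : Symmetric γ → Symmetric σγ
  σ-symmetric γ-sym u v = by-fibre (z u ≟ z w) (z v ≟ z w)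
    where
    by-fibre : Dec (z u ≡ z w) → Dec (z v ≡ z w) → σγ u v ≡ σγ v u
    by-fibre (yes u∈Q) (yes v∈Q) = trans (σ-inside u∈Q v∈Q) (sym (σ-inside v∈Q u∈Q))
    by-fibre (yes u∈Q) (no v∉Q)  = trans (σ-crossˡ u∈Q v∉Q) (sym (σ-crossʳ v∉Q u∈Q))
    by-fibre (no u∉Q)  (yes v∈Q) = trans (σ-crossʳ u∉Q v∈Q) (sym (σ-crossˡ v∈Q u∉Q))
    by-fibre (no u∉Q)  (no v∉Q)  = trans (σ-outside u∉Q v∉Q) (trans (γ-sym u v) (sym (σ-outside v∉Q u∉Q)))

  σ-column-fibre : ∀ {v} → z v ≢ z w → ∑[ Q ] (λ u → σγ u v) ≡ hubWeight v
  σ-column-fibre {v} v∉Q = begin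
    ∑[ Q ] (λ u → σγ u v)
      ≡⟨ ∑[]-cong Q (λ u u∈Q → σ-crossˡ (toWitness u∈Q) v∉Q) ⟩
    ∑ (λ u → [ Q u ] [ ⌊ u ≟ w ⌋ ] hubWeight v)
      ≡⟨ ∑-cong (λ u → []-comm (Q u) ⌊ u ≟ w ⌋ (hubWeight v)) ⟩
    ∑ (λ u → [ ⌊ u ≟ w ⌋ ] [ Q u ] hubWeight v)
      ≡⟨ ∑-δ w (λ u → [ Q u ] hubWeight v) ⟩
    [ Q w ] hubWeight v
      ≡⟨ cong ([_] hubWeight v) (⌊⌋-true (z w ≟ z w) refl) ⟩
    hubWeight v
      ∎

  blockSum-σ : ∀ R → (∀ v → T (R v) → z v ≢ z w) → blockSum σγ Q R ≡ blockSum γ Q R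
  blockSum-σ R R∩Q≡∅ = ∑[]-cong R (λ v v∈R → σ-column-fibre (R∩Q≡∅ v v∈R))

  σ-vertexSum-outside : ∀ {v} → z v ≢ z w → vertexSum σγ v ≡ vertexSum γ v
  σ-vertexSum-outside {v} v∉Q = vertexSum-cong σγ γ v column (σ-outside v∉Q v∉Q)
    where
    column : ∑ (λ u → σγ u v) ≡ ∑ (λ u → γ u v)
    column = begin
      ∑ (λ u → σγ u v)
        ≡⟨ ∑-split Q _ ⟩
      ∑[ Q ] (λ u → σγ u v) + ∑[ not ∘ Q ] (λ u → σγ u v)
        ≡⟨ cong₂ _+_ (σ-column-fibre v∉Q)
                     (∑[]-cong (not ∘ Q) (λ u u∉Q → σ-outside (toWitnessFalse u∉Q) v∉Q)) ⟩
      ∑[ Q ] (λ u → γ u v) + ∑[ not ∘ Q ] (λ u → γ u v)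
        ≡⟨ ∑-split Q _ ⟨
      ∑ (λ u → γ u v)
        ∎

  fibreCut : ℤ
  fibreCut = blockSum γ Q (not ∘ Q)

  σ-vertexSum-inside : ∀ {v} → z v ≡ z w → vertexSum σγ v ≡ [ ⌊ v ≟ w ⌋ ] fibreCut
  σ-vertexSum-inside {v} v∈Q = begin
    vertexSum σγ v
      ≡⟨ +-identityʳ _ ⟨
    vertexSum σγ v + 0ℤ
      ≡⟨ cong (vertexSum σγ v +_) (σ-inside v∈Q v∈Q) ⟨
    vertexSum σγ v + σγ v v
      ≡⟨ ∑-punctured v _ ⟩
    ∑ (λ u → σγ u v)
      ≡⟨ ∑-split Q _ ⟩
    ∑[ Q ] (λ u → σγ u v) + ∑[ not ∘ Q ] (λ u → σγ u v)
      ≡⟨ cong₂ _+_ (∑-zero (λ u → trans ([]-cong (Q u) (λ u∈Q → σ-inside (toWitness u∈Q) v∈Q))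
                                          ([]-zero (Q u))))
                   (∑[]-cong (not ∘ Q) (λ u u∉Q → σ-crossʳ (toWitnessFalse u∉Q) v∈Q)) ⟩
    0ℤ + ∑ (λ u → [ not (Q u) ] [ ⌊ v ≟ w ⌋ ] hubWeight u)
      ≡⟨ +-identityˡ _ ⟩
    ∑ (λ u → [ not (Q u) ] [ ⌊ v ≟ w ⌋ ] hubWeight u)
      ≡⟨ ∑-cong (λ u → []-comm (not (Q u)) ⌊ v ≟ w ⌋ (hubWeight u)) ⟩
    ∑ (λ u → [ ⌊ v ≟ w ⌋ ] [ not (Q u) ] hubWeight u)
      ≡⟨ ∑-[] ⌊ v ≟ w ⌋ _ ⟩
    [ ⌊ v ≟ w ⌋ ] fibreCut
      ∎

  fibreCut-zero : Symmetric γ → InKernel z γ → fibreCut ≡ 0ℤ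
  fibreCut-zero γ-sym (vertex , class) = begin
    fibreCut
      ≡⟨ blockSum-transpose γ γ-sym Q (not ∘ Q) ⟩
    blockSum γ (not ∘ Q) Q
      ≡⟨ +-identityˡ _ ⟨
    0ℤ + blockSum γ (not ∘ Q) Q
      ≡⟨ cong (_+ blockSum γ (not ∘ Q) Q) inside≡0 ⟨
    offDiagonalSum (onClass z (z w) (z w) γ) + blockSum γ (not ∘ Q) Q
      ≡⟨ ∑-vertexSum-fibre z γ (z w) ⟨
    ∑[ Q ] (vertexSum γ)
      ≡⟨ ∑-zero (λ v → trans (cong ([ Q v ]_) (vertex v)) ([]-zero (Q v))) ⟩
    0ℤ
      ∎
    where
    inside≡0 : offDiagonalSum (onClass z (z w) (z w) γ) ≡ 0ℤ
    inside≡0 = offDiagonalSum-onClass-zero z γ γ-sym (z w) (z w) (class (z w) (z w) ≤-refl)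

  σ-vertexSum-zero : Symmetric γ → InKernel z γ → ∀ v → vertexSum σγ v ≡ 0ℤ
  σ-vertexSum-zero γ-sym γ∈ker v = by-fibre (z v ≟ z w)
    where
    by-fibre : Dec (z v ≡ z w) → vertexSum σγ v ≡ 0ℤ
    by-fibre (no v∉Q)  = trans (σ-vertexSum-outside v∉Q) (proj₁ γ∈ker v)
    by-fibre (yes v∈Q) = begin
      vertexSum σγ v               ≡⟨ σ-vertexSum-inside v∈Q ⟩
      [ ⌊ v ≟ w ⌋ ] fibreCut       ≡⟨ cong ([ ⌊ v ≟ w ⌋ ]_) (fibreCut-zero γ-sym γ∈ker) ⟩
      [ ⌊ v ≟ w ⌋ ] 0ℤ             ≡⟨ []-zero _ ⟩
      0ℤ                           ∎

  σ-offDiagonalSum-cross : Symmetric γ → ∀ {r} → r ≢ z w →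
    offDiagonalSum (onClass z (z w) r σγ) ≡ offDiagonalSum (onClass z (z w) r γ)
  σ-offDiagonalSum-cross γ-sym {r} r≢q = begin
    offDiagonalSum (onClass z (z w) r σγ)     ≡⟨ offDiagonalSum-onClass-distinct z σγ (r≢q ∘ sym) ⟩
    blockSum σγ Q R + blockSum σγ R Q         ≡⟨ cong (blockSum σγ Q R +_) (blockSum-transpose σγ σγ-sym R Q) ⟩
    blockSum σγ Q R + blockSum σγ Q R         ≡⟨ cong₂ _+_ σ-block σ-block ⟩
    blockSum γ Q R + blockSum γ Q R           ≡⟨ cong (blockSum γ Q R +_) (blockSum-transpose γ γ-sym Q R) ⟩
    blockSum γ Q R + blockSum γ R Q           ≡⟨ offDiagonalSum-onClass-distinct z γ (r≢q ∘ sym) ⟨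
    offDiagonalSum (onClass z (z w) r γ)      ∎
    where
    R : Fin n → Bool
    R = fibre z r
    σγ-sym : Symmetric σγ
    σγ-sym = σ-symmetric γ-sym
    σ-block : blockSum σγ Q R ≡ blockSum γ Q R
    σ-block = blockSum-σ R (λ v v∈R v∈Q → r≢q (trans (sym (toWitness v∈R)) v∈Q))

  σ-offDiagonalSum-zero : Symmetric γ → ∀ i j →
    offDiagonalSum (onClass z i j γ) ≡ 0ℤ → offDiagonalSum (onClass z i j σγ) ≡ 0ℤ
  σ-offDiagonalSum-zero γ-sym i j γ-class≡0 = by-fibres (i ≟ z w) (j ≟ z w)
    where
    σ-onHubClass : ∀ u v → onClass z (z w) (z w) σγ u v ≡ 0ℤ
    σ-onHubClass u v = trans ([]-cong (edgeClass z (z w) (z w) u v) (λ uv∈Q →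
        let u∈Q , v∈Q = edgeClass-diagonal z uv∈Q in σ-inside u∈Q v∈Q))
      ([]-zero _)
    by-fibres : Dec (i ≡ z w) → Dec (j ≡ z w) → offDiagonalSum (onClass z i j σγ) ≡ 0ℤ
    by-fibres (yes refl) (yes refl) = ∑-zero (λ v → ∑-zero (λ u →
      trans (cong ([ not ⌊ u ≟ v ⌋ ]_) (σ-onHubClass u v)) ([]-zero _)))
    by-fibres (yes refl) (no j≢q) = trans (σ-offDiagonalSum-cross γ-sym j≢q) γ-class≡0
    by-fibres (no i≢q) (yes refl) = begin
      offDiagonalSum (onClass z i j σγ)   ≡⟨ offDiagonalSum-onClass-comm z σγ i j ⟩
      offDiagonalSum (onClass z j i σγ)   ≡⟨ σ-offDiagonalSum-cross γ-sym i≢q ⟩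
      offDiagonalSum (onClass z j i γ)    ≡⟨ offDiagonalSum-onClass-comm z γ j i ⟩
      offDiagonalSum (onClass z i j γ)    ≡⟨ γ-class≡0 ⟩
      0ℤ                                  ∎
    by-fibres (no i≢q) (no j≢q) = trans (offDiagonalSum-cong σ-onClass) γ-class≡0
      where
      σ-onClass : ∀ u v → onClass z i j σγ u v ≡ onClass z i j γ u v
      σ-onClass u v = []-cong (edgeClass z i j u v) (λ uv∈ij →
        let u∉Q , v∉Q = edgeClass-avoids z i≢q j≢q uv∈ij in σ-outside u∉Q v∉Q)

  σ-classSum-zero : Symmetric γ → InKernel z γ → ∀ i j → i ≤ j → classSum z σγ i j ≡ 0ℤ
  σ-classSum-zero γ-sym (_ , class) i j i≤j =
    classSum-zero z σγ (σ-symmetric γ-sym) i j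
      (σ-offDiagonalSum-zero γ-sym i j (offDiagonalSum-onClass-zero z γ γ-sym i j (class i j i≤j)))

lemma4p4 : (n k : ℕ) (z : Fin n → Fin k) (γ : Fin n → Fin n → ℤ)
    → Symmetric γ → InKernel z γ → (w : Fin n)
    → InKernel z (σ z w γ)
lemma4p4 n k z γ γ-sym γ∈ker w =
  σ-vertexSum-zero z w γ γ-sym γ∈ker , σ-classSum-zero z w γ γ-sym γ∈ker
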